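{- Let $n \in \mathbb{N}$, $n\ge1$, and let $\sigma$ be a permutation of $[n]$. If $\sigma$ is a prefix normal word chain generator, then $\sigma(1) \geq \lceil \frac{n+1}{2} \rceil$.
   Context: Words are over the binary alphabet $\{0,1\}$. For a word $w$, $|w|$ is its length, $|w|_1$ the number of occurrences of $1$ in $w$, and $\mathrm{pref}_k(w)$ its prefix of length $k$. A factor of $w$ is a contiguous subword $w[a..b]$. A word $w$ is prefix normal if for every factor $v$ of $w$ we have $|v|_1 \le |\mathrm{pref}_{|v|}(w)|_1$. A permutation $\sigma$ of $[n]$ is written in one-line notation with $\sigma[i]=\sigma(i)$. Its word chain $c_\sigma=(c_\sigma[1],\dots,c_\sigma[n+1])$ is the sequence of words of length $n$ with $c_\sigma[1]=1^n$ and, for $i\in[n]$, $c_\sigma[i+1]$ obtained from $c_\sigma[i]$ by changing the letter at position $\sigma(i)$ from $1$ to $0$. The permutation $\sigma$ is a prefix normal word chain generator if every word $c_\sigma[i]$, $i\in[n+1]$, is prefix normal. -}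

module Defs where

open import Data.Bool using (Bool; true; false; if_then_else_)
open import Data.Nat using (ℕ; zero; suc; _+_; _≤_; _<_; _<ᵇ_)
open import Data.Fin using (Fin; toℕ)
open import Data.Fin.Permutation using (Permutation′; _⟨$⟩ˡ_)
open import Data.List using (List; map; length)
open import Data.List.Base using (drop; take)
open import Data.Nat.ListAction using (sum)
open import Data.Vec using (Vec; toList; tabulate)

-- A binary word, as a list of letters; true = 1, false = 0.
Word : Set
Word = List Bool

ones : Word → ℕ
ones w = sum (map (λ b → if b then 1 else 0) w)

-- Factor w[a+1 .. a+ℓ] (0-indexed start a, length ℓ), meaningful when a + ℓ ≤ |w|
factor : Word → ℕ → ℕ → Word
factor w a ℓ = take ℓ (drop a w)

PrefixNormal : Word → Set
PrefixNormal w = ∀ (a ℓ : ℕ) → a + ℓ ≤ length w →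
  ones (factor w a ℓ) ≤ ones (take ℓ w)

-- Word chain of σ (positions 0-indexed: Fin n).  chain σ k is c_σ[k+1]
-- for k = 0..n: the letter at position p is 0 iff p ∈ {σ(1),…,σ(k)},
-- i.e. iff (0-indexed) σ⁻¹(p) < k.
chain : ∀ {n} → Permutation′ n → ℕ → Word
chain {n} σ k = toList (tabulate {n = n} (λ p → if toℕ (σ ⟨$⟩ˡ p) <ᵇ k then false else true))

PNGenerator : ∀ {n} → Permutation′ n → Set
PNGenerator {n} σ = ∀ (k : ℕ) → k ≤ n → PrefixNormal (chain σ k)

{-# OPTIONS --safe #-}
-- If m > p, the factor of length p + 1
-- just after the 0 is all ones, while the prefix of that length has only
-- p ones; so prefix normality forces m ≤ p, i.e. ⌈(n+1)/2⌉ ≤ σ(1).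
module Submission where

open import Defs
open import Data.Nat using (ℕ; suc; _+_; _≤_; _/_)
open import Data.Fin using (toℕ; zero)
open import Data.Fin.Permutation using (Permutation′; _⟨$⟩ʳ_)

open import Data.Bool using (Bool; true; false; if_then_else_)
open import Data.Fin using (Fin; suc)
import Data.Fin.Properties as Fin
open import Data.Fin.Permutation using (_⟨$⟩ˡ_; inverseˡ; inverseʳ)
open import Data.List using (_∷_; _++_; replicate; take; drop; length)
open import Data.List.Properties using (length-++; length-replicate)
open import Data.Nat using (zero; _*_; _∸_; _<_; _<ᵇ_; z≤n; s≤s)
open import Data.Nat.DivMod using (m<n*o⇒m/o<n)
open import Data.Nat.Properties
open import Data.Vec using (toList; tabulate)
open import Function using (_∘_)
open import Relation.Binary.PropositionalEquality
open import Relation.Nullary using (¬_; contradiction)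

private
  variable
    A : Set

ones-replicate-true : ∀ k → ones (replicate k true) ≡ k
ones-replicate-true zero    = refl
ones-replicate-true (suc k) = cong suc (ones-replicate-true k)

take-replicate : ∀ {k m} (x : A) → k ≤ m → take k (replicate m x) ≡ replicate k x
take-replicate x z≤n       = refl
take-replicate x (s≤s k≤m) = cong (x ∷_) (take-replicate x k≤m)

drop-replicate-++-∷ : ∀ p (x y : A) ys → drop (suc p) (replicate p x ++ y ∷ ys) ≡ ys
drop-replicate-++-∷ zero    x y ys = refl
drop-replicate-++-∷ (suc p) x y ys = drop-replicate-++-∷ p x y ys

length-replicate-++-∷ : ∀ p (x y : A) ys →
  length (replicate p x ++ y ∷ ys) ≡ p + suc (length ys)
length-replicate-++-∷ p x y ys =
  trans (length-++ (replicate p x)) (cong (_+ suc (length ys)) (length-replicate p))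

ones-take-suc-replicate-++-false : ∀ p ws →
  ones (take (suc p) (replicate p true ++ false ∷ ws)) ≡ p
ones-take-suc-replicate-++-false zero    ws = refl
ones-take-suc-replicate-++-false (suc p) ws = cong suc (ones-take-suc-replicate-++-false p ws)

prefixNormal-oneZeroOne⇒ : ∀ {p m} →
  PrefixNormal (replicate p true ++ false ∷ replicate m true) → m ≤ p
prefixNormal-oneZeroOne⇒ {p} {m} pn = ≮⇒≥ p<m-impossible
  where
  w : Word
  w = replicate p true ++ false ∷ replicate m true

  p<m-impossible : ¬ p < m
  p<m-impossible p<m = n≮n p (subst₂ _≤_ ones-after-zero ones-prefix factor≤prefix)
    where
    in-range : suc p + suc p ≤ length w
    in-range = begin
      suc p + suc p      ≤⟨ +-monoʳ-≤ (suc p) p<m ⟩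
      suc (p + m)        ≡⟨ sym (+-suc p m) ⟩
      p + suc m          ≡⟨ sym (cong (λ k → p + suc k) (length-replicate m)) ⟩
      p + suc (length (replicate m true))
                         ≡⟨ sym (length-replicate-++-∷ p true false (replicate m true)) ⟩
      length w           ∎
      where open ≤-Reasoning

    factor≤prefix : ones (factor w (suc p) (suc p)) ≤ ones (take (suc p) w)
    factor≤prefix = pn (suc p) (suc p) in-range

    ones-after-zero : ones (factor w (suc p) (suc p)) ≡ suc p
    ones-after-zero = begin
      ones (take (suc p) (drop (suc p) w))
        ≡⟨ cong (ones ∘ take (suc p)) (drop-replicate-++-∷ p true false (replicate m true)) ⟩
      ones (take (suc p) (replicate m true))
        ≡⟨ cong ones (take-replicate true p<m) ⟩
      ones (replicate (suc p) true)
        ≡⟨ ones-replicate-true (suc p) ⟩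
      suc p ∎
      where open ≡-Reasoning

    ones-prefix : ones (take (suc p) w) ≡ p
    ones-prefix = ones-take-suc-replicate-++-false p (replicate m true)

toList-tabulate-true : ∀ {n} (f : Fin n → Bool) → (∀ q → f q ≡ true) →
  toList (tabulate f) ≡ replicate n true
toList-tabulate-true {zero}  f f≡true = refl
toList-tabulate-true {suc n} f f≡true =
  cong₂ _∷_ (f≡true zero) (toList-tabulate-true (f ∘ suc) (f≡true ∘ suc))

toList-tabulate-single-false : ∀ {n} (i : Fin (suc n)) (f : Fin (suc n) → Bool) →
  f i ≡ false → (∀ q → q ≢ i → f q ≡ true) →
  toList (tabulate f) ≡ replicate (toℕ i) true ++ false ∷ replicate (n ∸ toℕ i) true
toList-tabulate-single-false zero f fi≡false f≡true =
  cong₂ _∷_ fi≡false (toList-tabulate-true (f ∘ suc) (λ q → f≡true (suc q) λ ()))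
toList-tabulate-single-false {suc n} (suc i) f fi≡false f≡true =
  cong₂ _∷_ (f≡true zero λ ())
    (toList-tabulate-single-false i (f ∘ suc) fi≡false
      (λ q q≢i → f≡true (suc q) (q≢i ∘ Fin.suc-injective)))

chain-one : ∀ {n} (σ : Permutation′ (suc n)) → let p = toℕ (σ ⟨$⟩ʳ zero) in
  chain σ 1 ≡ replicate p true ++ false ∷ replicate (n ∸ p) true
chain-one σ = toList-tabulate-single-false (σ ⟨$⟩ʳ zero) _ first-erased others-kept
  where
  first-erased : (if toℕ (σ ⟨$⟩ˡ (σ ⟨$⟩ʳ zero)) <ᵇ 1 then false else true) ≡ false
  first-erased rewrite inverseˡ σ {zero} = refl

  others-kept : ∀ q → q ≢ σ ⟨$⟩ʳ zero → (if toℕ (σ ⟨$⟩ˡ q) <ᵇ 1 then false else true) ≡ true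
  others-kept q q≢σ0 with σ ⟨$⟩ˡ q in eq
  ... | zero  = contradiction (trans (sym (inverseʳ σ)) (cong (σ ⟨$⟩ʳ_) eq)) q≢σ0
  ... | suc _ = refl

half-bound : ∀ {n p} → n ∸ p ≤ p → (suc n + 2) / 2 ≤ suc p
half-bound {n} {p} n∸p≤p = ≤-pred (m<n*o⇒m/o<n {o = 2} (begin-strict
  suc n + 2             ≡⟨ +-comm (suc n) 2 ⟩
  3 + n                 ≤⟨ +-monoʳ-≤ 3 (≤-trans (m≤n+m∸n n p) (+-monoʳ-≤ p n∸p≤p)) ⟩
  3 + (p + p)           <⟨ ≤-refl ⟩
  4 + (p + p)           ≡⟨ cong (λ k → 4 + (p + k)) (sym (+-identityʳ p)) ⟩
  4 + 2 * p             ≡⟨ cong (4 +_) (*-comm 2 p) ⟩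
  4 + p * 2             ∎))
  where open ≤-Reasoning

mainTheorem2 : (n : ℕ) → (σ : Permutation′ (suc n)) → PNGenerator σ →
    (suc n + 2) / 2 ≤ suc (toℕ (σ ⟨$⟩ʳ zero))
mainTheorem2 n σ gen =
  half-bound (prefixNormal-oneZeroOne⇒ (subst PrefixNormal (chain-one σ) (gen 1 (s≤s z≤n))))
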